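{- Let $(\mathcal{R},\leq,r)$ be an \textbf{A2}-space. Then the following are equivalent: (1) $(\mathcal{R},\leq,r)$ satisfies Axiom \textbf{A4}; (2) every clopen subset of $\mathcal{R}$ (in the metrisable topology) is Ramsey.
   Context: $\mathcal{R}$ nonempty, $\le$ a quasi-order on $\mathcal{R}$, $r:\mathcal{R}\times\omega\to\mathcal{AR}$, $r_n(A):=r(A,n)$, $\mathcal{AR}_n$ the image of $r_n$. A1: (1) $r_0(A)=\emptyset$; (2) $A\ne B\Rightarrow r_n(A)\ne r_n(B)$ for some $n$; (3) $r_n(A)=r_m(B)\Rightarrow n=m$ and $r_k(A)=r_k(B)$ for $k<n$. $\mathrm{lh}(a)$: the $n$ with $a\in\mathcal{AR}_n$; $a\sqsubseteq b$ iff $a=r_m(A)$, $b=r_n(A)$ for some $A$, $m\le n$. A2: a quasi-order $\leq_{\mathrm{fin}}$ on $\mathcal{AR}$ with (1) $\{a:a\leq_{\mathrm{fin}}b\}$ finite; (2) $A\le B$ iff $\forall n\exists m\ r_n(A)\leq_{\mathrm{fin}}r_m(B)$; (3) $a\sqsubseteq b\leq_{\mathrm{fin}}c\Rightarrow\exists d\sqsubseteq c\ a\leq_{\mathrm{fin}}d$. $[a,A]=\{B\le A:\exists n\ r_n(B)=a\}$; $[n,A]=[r_n(A),A]$; $\mathrm{depth}_B(a)=\min\{n:a\leq_{\mathrm{fin}}r_n(B)\}$ or $\infty$; $\mathcal{AR}{\upharpoonright}A=\{a:\exists n\ a\leq_{\mathrm{fin}}r_n(A)\}$; $r_n[a,A]=\{b\in\mathcal{AR}{\upharpoonright}A:a\sqsubseteq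 b,\mathrm{lh}(b)=n\}$. A3: (1) $\mathrm{depth}_B(a)<\infty\Rightarrow[a,A]\ne\emptyset$ for all $A\in[\mathrm{depth}_B(a),B]$; (2) $A\le B$, $[a,A]\ne\emptyset\Rightarrow\exists A'\in[\mathrm{depth}_B(a),B]$ with $\emptyset\ne[a,A']\subseteq[a,A]$. A4: if $\mathrm{depth}_B(a)<\infty$ and $\mathcal{O}\subseteq\mathcal{AR}_{\mathrm{lh}(a)+1}$ then there is $A\in[\mathrm{depth}_B(a),B]$ with $r_{\mathrm{lh}(a)+1}[a,A]\subseteq\mathcal{O}$ or $\subseteq\mathcal{O}^c$. An \textbf{A2}-space is such a triple satisfying A1, A2, A3 with $\mathcal{R}$ (identified via $A\mapsto(r_n(A))_n$) a closed subset of $\mathcal{AR}^{\mathbb N}$. The metrisable topology is given by the first-difference metric $d(A,B)=2^{ -n}$, $n$ least with $r_n(A)\ne r_n(B)$. $\mathcal{X}\subseteq\mathcal{R}$ is Ramsey if for all $A$ and $a\in\mathcal{AR}{\upharpoonright}A$ there is $B\in[a,A]$ with $[a,B]\subseteq\mathcal{X}$ or $[a,B]\subseteq\mathcal{X}^c$. -}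

module Defs where

open import Data.Nat using (ℕ; zero; suc) renaming (_≤_ to _≤ℕ_; _<_ to _<ℕ_)
open import Data.Product using (Σ; Σ-syntax; _×_; _,_)
open import Data.Sum using (_⊎_)
open import Data.List using (List)
open import Data.List.Membership.Propositional using (_∈_)
open import Relation.Binary.PropositionalEquality using (_≡_; _≢_)
open import Relation.Nullary using (¬_)

record A2Space : Set₁ where
  field
    R        : Set
    AR       : Set
    inhabited : R
    _≤_      : R → R → Set
    ≤-refl   : ∀ A → A ≤ A
    ≤-trans  : ∀ {A B C} → A ≤ B → B ≤ C → A ≤ C
    r        : R → ℕ → AR
    ∅        : AR

  -- a ∈ AR_n  (AR_n = image of r_n);  "lh(a) = n"
  HasLength : AR → ℕ → Set
  HasLength a n = Σ[ A ∈ R ] r A n ≡ a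

  _⊑_ : AR → AR → Set
  a ⊑ b = Σ[ A ∈ R ] Σ[ m ∈ ℕ ] Σ[ n ∈ ℕ ] (m ≤ℕ n × r A m ≡ a × r A n ≡ b)

  field
    A1-1 : ∀ A → r A 0 ≡ ∅
    A1-2 : ∀ A B → A ≢ B → Σ[ n ∈ ℕ ] r A n ≢ r B n
    A1-3 : ∀ A B n m → r A n ≡ r B m →
             (n ≡ m) × (∀ k → k <ℕ n → r A k ≡ r B k)
    _≤fin_      : AR → AR → Set
    ≤fin-refl   : ∀ a → a ≤fin a
    ≤fin-trans  : ∀ {a b c} → a ≤fin b → b ≤fin c → a ≤fin c
    A2-1 : ∀ b → Σ[ l ∈ List AR ] (∀ a → a ≤fin b → a ∈ l)
    A2-2 : ∀ A B → (A ≤ B → ∀ n → Σ[ m ∈ ℕ ] r A n ≤fin r B m)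
                 × ((∀ n → Σ[ m ∈ ℕ ] r A n ≤fin r B m) → A ≤ B)
    A2-3 : ∀ a b c → a ⊑ b → b ≤fin c → Σ[ d ∈ AR ] (d ⊑ c × a ≤fin d)

  _∈[_,_] : R → AR → R → Set
  B ∈[ a , A ] = B ≤ A × Σ[ n ∈ ℕ ] r B n ≡ a

  NonEmpty[_,_] : AR → R → Set
  NonEmpty[ a , A ] = Σ[ B ∈ R ] B ∈[ a , A ]

  -- depth_B(a) = d  (d is the least n with a ≤fin r_n(B));
  -- depth_B(a) < ∞ iff such a d exists
  IsDepth : R → AR → ℕ → Set
  IsDepth B a d = a ≤fin r B d × (∀ m → a ≤fin r B m → d ≤ℕ m)

  _∈AR↾_ : AR → R → Set
  a ∈AR↾ A = Σ[ n ∈ ℕ ] a ≤fin r A n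

  _∈r[_][_,_] : AR → ℕ → AR → R → Set
  b ∈r[ n ][ a , A ] = b ∈AR↾ A × a ⊑ b × HasLength b n

  field
    A3-1 : ∀ B a d → IsDepth B a d →
             ∀ A → A ∈[ r B d , B ] → NonEmpty[ a , A ]
    A3-2 : ∀ A B a → A ≤ B → NonEmpty[ a , A ] → ∀ d → IsDepth B a d →
             Σ[ A′ ∈ R ] (A′ ∈[ r B d , B ] × NonEmpty[ a , A′ ]
                          × (∀ C → C ∈[ a , A′ ] → C ∈[ a , A ]))
    -- R, identified with {(r_n(A))_n}, is closed in AR^ℕ (AR discrete)
    closed : ∀ (f : ℕ → AR) →
               (∀ n → Σ[ A ∈ R ] (∀ k → k <ℕ n → r A k ≡ f k)) →
               Σ[ A ∈ R ] (∀ k → r A k ≡ f k)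

module _ (S : A2Space) where
  open A2Space S

  A4 : Set₁
  A4 = ∀ B a d → IsDepth B a d → ∀ n → HasLength a n →
         ∀ (O : AR → Set) →
         Σ[ A ∈ R ] (A ∈[ r B d , B ] ×
           ((∀ b → b ∈r[ suc n ][ a , A ] → O b)
            ⊎ (∀ b → b ∈r[ suc n ][ a , A ] → ¬ O b)))

  -- open sets in the first-difference metric topology:
  -- every point has a ball {B : r_k(B) = r_k(A) for k < n} inside X
  IsOpen : (R → Set) → Set
  IsOpen X = ∀ A → X A → Σ[ n ∈ ℕ ]
               (∀ B → (∀ k → k <ℕ n → r B k ≡ r A k) → X B)

  IsClopen : (R → Set) → Set
  IsClopen X = IsOpen X × IsOpen (λ A → ¬ X A)

  Ramsey : (R → Set) → Set
  Ramsey X = ∀ A a → a ∈AR↾ A →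
    Σ[ B ∈ R ] (B ∈[ a , A ] ×
      ((∀ C → C ∈[ a , B ] → X C) ⊎ (∀ C → C ∈[ a , B ] → ¬ X C)))

{-# OPTIONS --safe #-}
module Submission where

-- (1 ⇒ 2) holds for every open X.  Say A accepts b if [b, A] ⊆ X, and rejects b if no
-- B ≤ A with [b, B] ≠ ∅ accepts b.  Given a of depth d in A, two fusion arguments give
-- A₂ ∈ [d, A] which decides every b of depth ≥ d and, by A4, either accepts b or rejects
-- all its one-step extensions.  If A₂ rejects a, then for C ∈ [a, A₂] every r_i(C) with
-- i ≥ lh(a) is rejected, whereas if C ∈ X, openness at C makes some r_N(C) accepted.
-- (2 ⇒ 1) {C : r_{n+1}(C) ∈ O} is clopen.  A homogeneous [a, B′] for it shrinks by A3(2)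
-- to some [a, A] with A ∈ [depth_B(a), B], and by A3(1) each b ∈ r_{n+1}[a, A] is
-- r_{n+1}(C) for some C ∈ [a, A].

open import Defs
open import Level using (0ℓ)
open import Data.Product using (_×_; Σ; Σ-syntax; _,_; proj₁; proj₂)
open import Axiom.ExcludedMiddle using (ExcludedMiddle)

open import Data.Nat using (ℕ; zero; suc; _+_; z≤n; s≤s; _<?_) renaming (_≤_ to _≤ℕ_; _<_ to _<ℕ_)
open import Data.Nat.Properties
  using (m≤n⇒m<n∨m≡n; ≮⇒≥; <⇒≱; <⇒≤; <-≤-trans; n≤1+n; n<1+n; m≤n+m; m≤m+n)
  renaming (≤-refl to ≤ℕ-refl; ≤-trans to ≤ℕ-trans)
open import Data.Nat.Induction using (<-rec)
open import Data.Sum using (_⊎_; inj₁; inj₂) renaming (map to ⊎-map)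
open import Data.Empty using (⊥-elim)
open import Data.List using (List; []; _∷_)
open import Data.List.Membership.Propositional using (_∈_)
open import Data.List.Relation.Unary.Any using (here; there)
open import Relation.Binary.PropositionalEquality using (_≡_; refl; sym; trans; subst)
open import Relation.Nullary using (¬_; yes; no)

Least : (ℕ → Set) → Set
Least P = Σ[ d ∈ ℕ ] (P d × (∀ k → P k → d ≤ℕ k))

least-number-principle : ExcludedMiddle 0ℓ → (P : ℕ → Set) → ∀ m → P m → Least P
least-number-principle em P = <-rec (λ m → P m → Least P) search
  where
    search : ∀ m → (∀ {j} → j <ℕ m → P j → Least P) → P m → Least P
    search m below pm with em {Σ[ j ∈ ℕ ] (j <ℕ m × P j)}
    ... | yes (j , j<m , pj) = below j<m pj
    ... | no none = m , pm , λ k pk → ≮⇒≥ (λ k<m → none (k , k<m , pk))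

module A2Theory (S : A2Space) where
  open A2Space S

  r-length-unique : ∀ {A B n m} → r A n ≡ r B m → n ≡ m
  r-length-unique {A} {B} {n} {m} e = proj₁ (A1-3 A B n m e)

  r-⊑ : ∀ {C i j} → i ≤ℕ j → r C i ⊑ r C j
  r-⊑ {C} {i} {j} i≤j = C , i , j , i≤j , refl , refl

  ⊑-r : ∀ {a C k} → a ⊑ r C k → Σ[ i ∈ ℕ ] (i ≤ℕ k × r C i ≡ a)
  ⊑-r {a} {C} {k} (D , i , j , i≤j , eDi , eDj) with A1-3 D C j k eDj
  ... | refl , agree with m≤n⇒m<n∨m≡n i≤j
  ...   | inj₁ i<j = i , i≤j , trans (sym (agree i i<j)) eDi
  ...   | inj₂ refl = i , i≤j , trans (sym eDj) eDi

  ∈[]-mono : ∀ {A B C b} → B ≤ A → C ∈[ b , B ] → C ∈[ b , A ]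
  ∈[]-mono B≤A (C≤B , C-hits-b) = ≤-trans C≤B B≤A , C-hits-b

  ∈[r]-refl : ∀ A n → A ∈[ r A n , A ]
  ∈[r]-refl A n = ≤-refl A , n , refl

  ∈[r]-agree : ∀ {A B n} → B ∈[ r A n , A ] → ∀ k → k ≤ℕ n → r B k ≡ r A k
  ∈[r]-agree {A} {B} {n} (_ , m , e) k k≤n with r-length-unique e
  ... | refl with m≤n⇒m<n∨m≡n k≤n
  ...   | inj₁ k<n = proj₂ (A1-3 B A n n e) k k<n
  ...   | inj₂ refl = e

  ∈[r]-trans : ∀ {A B C m n} → m ≤ℕ n → C ∈[ r B n , B ] → B ∈[ r A m , A ] → C ∈[ r A m , A ]
  ∈[r]-trans {m = m} m≤n C∈ B∈ =
    ≤-trans (proj₁ C∈) (proj₁ B∈) , m , trans (∈[r]-agree C∈ m m≤n) (∈[r]-agree B∈ m ≤ℕ-refl)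

  ∈AR↾-mono : ∀ {A B b} → B ≤ A → b ∈AR↾ B → b ∈AR↾ A
  ∈AR↾-mono {A} {B} B≤A (n , b≤) with proj₁ (A2-2 B A) B≤A n
  ... | m , q = m , ≤fin-trans b≤ q

  r-∈AR↾ : ∀ {A C} → C ≤ A → ∀ k → r C k ∈AR↾ A
  r-∈AR↾ {A} {C} = proj₁ (A2-2 C A)

  r-∈r[] : ∀ {A C i j} → C ≤ A → i ≤ℕ j → r C j ∈r[ j ][ r C i , A ]
  r-∈r[] {C = C} C≤A i≤j = r-∈AR↾ C≤A _ , r-⊑ i≤j , (C , refl)

  IsDepth⇒HasLength : ∀ {A b d} → IsDepth A b d → Σ[ k ∈ ℕ ] HasLength b k
  IsDepth⇒HasLength {A} {b} {d} b-depth with A3-1 A b d b-depth A (∈[r]-refl A d)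
  ... | C , _ , k , eC = k , C , eC

  HasLength-unique : ∀ {b k l} → HasLength b k → HasLength b l → k ≡ l
  HasLength-unique (_ , eb) (_ , eb′) = r-length-unique (trans eb (sym eb′))

  DepthAtLeast : R → AR → ℕ → Set
  DepthAtLeast A b d = ∀ m → b ≤fin r A m → d ≤ℕ m

  DepthAtLeast-weaken : ∀ {A b d n} → d ≤ℕ n → DepthAtLeast A b n → DepthAtLeast A b d
  DepthAtLeast-weaken d≤n deep m b≤ = ≤ℕ-trans d≤n (deep m b≤)

  DepthAtLeast-transfer : ∀ {A B b d} → (∀ k → k <ℕ d → r A k ≡ r B k) →
                          DepthAtLeast A b d → DepthAtLeast B b d
  DepthAtLeast-transfer {A} {B} {b} {d} agree deep m b≤ with m <? d
  ... | yes m<d = ⊥-elim (<⇒≱ m<d (deep m (subst (b ≤fin_) (sym (agree m m<d)) b≤)))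
  ... | no m≮d = ≮⇒≥ m≮d

  DepthAtLeast-⊑ : ∀ {A a b d} → a ⊑ b → DepthAtLeast A a d → DepthAtLeast A b d
  DepthAtLeast-⊑ {A} {a} {b} a⊑b deep m b≤ with A2-3 a b (r A m) a⊑b b≤
  ... | e , e⊑ , a≤e with ⊑-r e⊑
  ...   | i , i≤m , refl = ≤ℕ-trans (deep i a≤e) i≤m

  IsDepth-transfer : ∀ {A B b d} → (∀ k → k ≤ℕ d → r A k ≡ r B k) → IsDepth A b d → IsDepth B b d
  IsDepth-transfer {b = b} agree (b≤ , deep) =
    subst (b ≤fin_) (agree _ ≤ℕ-refl) b≤ , DepthAtLeast-transfer (λ k k<d → agree k (<⇒≤ k<d)) deep

  IsDepth-∈[r] : ∀ {A B b n} → B ∈[ r A n , A ] → IsDepth A b n → IsDepth B b n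
  IsDepth-∈[r] B∈ = IsDepth-transfer (λ k k≤n → sym (∈[r]-agree B∈ k k≤n))

  IsDepth-∈[r]⁻ : ∀ {A B b n} → B ∈[ r A n , A ] → IsDepth B b n → IsDepth A b n
  IsDepth-∈[r]⁻ B∈ = IsDepth-transfer (∈[r]-agree B∈)

  Hereditary : (R → AR → Set) → Set
  Hereditary Q = ∀ {A B b} → B ≤ A → Q A b → Q B b

  HoldsBeyond : (R → AR → Set) → ℕ → R → Set
  HoldsBeyond Q d A = ∀ b → b ∈AR↾ A → DepthAtLeast A b d → Q A b

  HoldsBeyond-∈[r] : ∀ {Q A B d} → Hereditary Q → B ∈[ r A d , A ] →
                     HoldsBeyond Q d A → HoldsBeyond Q d B
  HoldsBeyond-∈[r] Q-her B∈ holds b b∈ deep =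
    Q-her (proj₁ B∈) (holds b (∈AR↾-mono (proj₁ B∈) b∈)
                              (DepthAtLeast-transfer (λ k k<d → ∈[r]-agree B∈ k (<⇒≤ k<d)) deep))

  fusion-sequence-limit : (A : ℕ → R) → (∀ n → A (suc n) ∈[ r (A n) n , A n ]) →
                          Σ[ A∞ ∈ R ] (∀ n → A∞ ∈[ r (A n) n , A n ])
  fusion-sequence-limit A shrinks = A∞ , λ n → A∞≤ n , n , r-A∞ n
    where
      stable : ∀ {k n} → k ≤ℕ n → r (A n) k ≡ r (A k) k
      stable {k} {zero} z≤n = refl
      stable {k} {suc n} k≤1+n with m≤n⇒m<n∨m≡n k≤1+n
      ... | inj₁ (s≤s k≤n) = trans (∈[r]-agree (shrinks n) k k≤n) (stable k≤n)
      ... | inj₂ refl = refl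

      decreasing : ∀ i n → A (i + n) ≤ A n
      decreasing zero n = ≤-refl (A n)
      decreasing (suc i) n = ≤-trans (proj₁ (shrinks (i + n))) (decreasing i n)

      limit : Σ[ A∞ ∈ R ] (∀ k → r A∞ k ≡ r (A k) k)
      limit = closed (λ k → r (A k) k) (λ n → A n , λ k k<n → stable (<⇒≤ k<n))

      A∞ : R
      A∞ = proj₁ limit

      r-A∞ : ∀ k → r A∞ k ≡ r (A k) k
      r-A∞ = proj₂ limit

      A∞≤ : ∀ n → A∞ ≤ A n
      A∞≤ n = proj₂ (A2-2 A∞ (A n)) below
        where
          below : ∀ k → Σ[ m ∈ ℕ ] (r A∞ k ≤fin r (A n) m)
          below k with proj₁ (A2-2 (A (k + n)) (A n)) (decreasing k n) k
          ... | m , q = m , subst (_≤fin r (A n) m) (trans (stable (m≤m+n k n)) (sym (r-A∞ k))) q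

  r-preimage-open : ∀ m (P : AR → Set) → IsOpen S (λ C → P (r C m))
  r-preimage-open m P A PA = suc m , λ B agree → subst P (sym (agree m (n<1+n m))) PA

  r-preimage-clopen : ∀ m (P : AR → Set) → IsClopen S (λ C → P (r C m))
  r-preimage-clopen m P = r-preimage-open m P , r-preimage-open m (λ b → ¬ P b)

  module Classical (em : ExcludedMiddle 0ℓ) where

    depth-exists : ∀ {A b} → b ∈AR↾ A → Σ[ d ∈ ℕ ] IsDepth A b d
    depth-exists {A} {b} (m , b≤) = least-number-principle em (λ k → b ≤fin r A k) m b≤

    ∈r[]-lift : ∀ {A a b n} → b ∈r[ n ][ a , A ] → Σ[ C ∈ R ] (C ∈[ a , A ] × r C n ≡ b)
    ∈r[]-lift {A} {a} {b} (b∈ , a⊑b , (_ , eb)) with depth-exists b∈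
    ... | e , b-depth with A3-1 A b e b-depth A (∈[r]-refl A e)
    ...   | C , C≤A , k , eC with r-length-unique (trans eC (sym eb))
    ...     | refl with ⊑-r (subst (a ⊑_) (sym eC) a⊑b)
    ...       | i , _ , eCi = C , (C≤A , i , eCi) , eC

    ∈r[]-all : ∀ {A a n} (P : AR → Set) → (∀ C → C ∈[ a , A ] → P (r C n)) →
               ∀ b → b ∈r[ n ][ a , A ] → P b
    ∈r[]-all P all b b∈ with ∈r[]-lift b∈
    ... | C , C∈ , refl = all C C∈

    -- Stage n shrinks A inside [n, A] once for each of the finitely many b ≤fin r_n(A)
    -- of depth n; the limit of the resulting fusion sequence serves every b of depth ≥ d.
    module Fusion (Q : R → AR → Set) (Q-her : Hereditary Q) (d : ℕ) (A₀ : R)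
                  (step : ∀ {A b n} → A ∈[ r A₀ d , A₀ ] → d ≤ℕ n → IsDepth A b n →
                          Σ[ A′ ∈ R ] (A′ ∈[ r A n , A ] × Q A′ b)) where

      private
        Stage : ℕ → R → (AR → Set) → Set
        Stage n A Handled = Σ[ A′ ∈ R ] (A′ ∈[ r A n , A ] × A′ ∈[ r A₀ d , A₀ ] ×
                                         (∀ b → Handled b → d ≤ℕ n → IsDepth A b n → Q A′ b))

        stage-list : ∀ n A → A ∈[ r A₀ d , A₀ ] → (l : List AR) → Stage n A (_∈ l)
        stage-list n A A∈ [] = A , ∈[r]-refl A n , A∈ , λ _ ()
        stage-list n A A∈ (b ∷ l) with em {d ≤ℕ n × IsDepth A b n} | stage-list n A A∈ l
        ... | no irrelevant | A′ , A′∈ , A′∈₀ , handled = A′ , A′∈ , A′∈₀ , handled′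
          where
            handled′ : ∀ c → c ∈ b ∷ l → d ≤ℕ n → IsDepth A c n → Q A′ c
            handled′ c (here refl) d≤n c-depth = ⊥-elim (irrelevant (d≤n , c-depth))
            handled′ c (there c∈l) = handled c c∈l
        ... | yes (d≤n , b-depth) | _ with step A∈ d≤n b-depth
        ...   | A₁ , A₁∈ , Q-b with stage-list n A₁ (∈[r]-trans d≤n A₁∈ A∈) l
        ...     | A′ , A′∈ , A′∈₀ , handled = A′ , ∈[r]-trans ≤ℕ-refl A′∈ A₁∈ , A′∈₀ , handled′
          where
            handled′ : ∀ c → c ∈ b ∷ l → d ≤ℕ n → IsDepth A c n → Q A′ c
            handled′ c (here refl) _ _ = Q-her (proj₁ A′∈) Q-b
            handled′ c (there c∈l) d≤n c-depth = handled c c∈l d≤n (IsDepth-∈[r] A₁∈ c-depth)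

        stage : ∀ n A → A ∈[ r A₀ d , A₀ ] → Stage n A (_≤fin r A n)
        stage n A A∈ with A2-1 (r A n)
        ... | l , listed with stage-list n A A∈ l
        ...   | A′ , A′∈ , A′∈₀ , handled = A′ , A′∈ , A′∈₀ , λ b b≤ → handled b (listed b b≤)

        sequence : ℕ → Σ[ A ∈ R ] A ∈[ r A₀ d , A₀ ]
        sequence zero = A₀ , ∈[r]-refl A₀ d
        sequence (suc n) = let (A , A∈) = sequence n
                               (A′ , _ , A′∈₀ , _) = stage n A A∈
                           in A′ , A′∈₀

        Aₙ : ℕ → R
        Aₙ n = proj₁ (sequence n)

        stageₙ : ∀ n → Stage n (Aₙ n) (_≤fin r (Aₙ n) n)
        stageₙ n = stage n (Aₙ n) (proj₂ (sequence n))

        limit : Σ[ A∞ ∈ R ] (∀ n → A∞ ∈[ r (Aₙ n) n , Aₙ n ])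
        limit = fusion-sequence-limit Aₙ (λ n → proj₁ (proj₂ (stageₙ n)))

        A∞ : R
        A∞ = proj₁ limit

        A∞∈ : ∀ n → A∞ ∈[ r (Aₙ n) n , Aₙ n ]
        A∞∈ = proj₂ limit

        holds : HoldsBeyond Q d A∞
        holds b b∈ deep with depth-exists b∈
        ... | e , b-depth with IsDepth-∈[r]⁻ (A∞∈ e) b-depth
        ...   | b-depthₑ@(b≤ , _) =
                Q-her (proj₁ (A∞∈ (suc e)))
                      (proj₂ (proj₂ (proj₂ (stageₙ e))) b b≤ (deep e (proj₁ b-depth)) b-depthₑ)

      fusion : Σ[ A ∈ R ] (A ∈[ r A₀ d , A₀ ] × HoldsBeyond Q d A)
      fusion = A∞ , ∈[r]-trans ≤ℕ-refl (A∞∈ d) (proj₂ (sequence d)) , holds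

    open Fusion using (fusion)

    module _ {X : R → Set} where

      Accepts : R → AR → Set
      Accepts A b = ∀ C → C ∈[ b , A ] → X C

      Rejects : R → AR → Set
      Rejects A b = ∀ B → B ≤ A → NonEmpty[ b , B ] → ¬ Accepts B b

      Decides : R → AR → Set
      Decides A b = Accepts A b ⊎ Rejects A b

      RejectsSuccessors : R → AR → Set
      RejectsSuccessors A b = ∀ {k c} → HasLength b k → c ∈r[ suc k ][ b , A ] → Rejects A c

      AcceptsOrRejectsSuccessors : R → AR → Set
      AcceptsOrRejectsSuccessors A b = Accepts A b ⊎ RejectsSuccessors A b

      Accepts-hereditary : Hereditary Accepts
      Accepts-hereditary B≤A accepts C C∈ = accepts C (∈[]-mono B≤A C∈)

      Rejects-hereditary : Hereditary Rejects
      Rejects-hereditary B≤A rejects B′ B′≤B = rejects B′ (≤-trans B′≤B B≤A)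

      RejectsSuccessors-hereditary : Hereditary RejectsSuccessors
      RejectsSuccessors-hereditary B≤A rejects b-len c∈ =
        Rejects-hereditary B≤A (rejects b-len (∈AR↾-mono B≤A (proj₁ c∈) , proj₂ c∈))

      Decides-hereditary : Hereditary Decides
      Decides-hereditary B≤A = ⊎-map (Accepts-hereditary B≤A) (Rejects-hereditary B≤A)

      AcceptsOrRejectsSuccessors-hereditary : Hereditary AcceptsOrRejectsSuccessors
      AcceptsOrRejectsSuccessors-hereditary B≤A =
        ⊎-map (Accepts-hereditary B≤A) (RejectsSuccessors-hereditary B≤A)

      Rejects⇒¬Accepts : ∀ {A b C} → C ∈[ b , A ] → Rejects A b → ¬ Accepts A b
      Rejects⇒¬Accepts {A} C∈ rejects = rejects A (≤-refl A) (_ , C∈)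

      decide : ∀ {A b n} → IsDepth A b n → Σ[ A′ ∈ R ] (A′ ∈[ r A n , A ] × Decides A′ b)
      decide {A} {b} {n} b-depth with em {Σ[ B ∈ R ] (B ≤ A × NonEmpty[ b , B ] × Accepts B b)}
      ... | yes (B , B≤A , nonempty , accepts) with A3-2 B A b B≤A nonempty n b-depth
      ...   | A′ , A′∈ , _ , shrinks = A′ , A′∈ , inj₁ (λ C C∈ → accepts C (shrinks C C∈))
      decide {A} {b} {n} b-depth | no none =
        A , ∈[r]-refl A n , inj₂ (λ B B≤A nonempty accepts → none (B , B≤A , nonempty , accepts))

      successors-accepted⇒accepted : ∀ {A b k} → HasLength b k →
        (∀ c → c ∈r[ suc k ][ b , A ] → Accepts A c) → Accepts A b
      successors-accepted⇒accepted b-len successors C (C≤A , j , refl) with HasLength-unique b-len (C , refl)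
      ... | refl = successors (r C (suc j)) (r-∈r[] C≤A (n≤1+n j)) C (C≤A , suc j , refl)

      -- A4 colours the successors of b by rejection; since A decides them, a colour class
      -- with none rejected has all accepted, and then b itself is accepted.
      accept-or-reject-successors :
        A4 S → ∀ {d A₁} → HoldsBeyond Decides d A₁ →
        ∀ {A b n} → A ∈[ r A₁ d , A₁ ] → d ≤ℕ n → IsDepth A b n →
        Σ[ A′ ∈ R ] (A′ ∈[ r A n , A ] × AcceptsOrRejectsSuccessors A′ b)
      accept-or-reject-successors a4 A₁-decides {A} {b} {n} A∈ d≤n b-depth
        with IsDepth⇒HasLength b-depth
      ... | k , b-len with a4 A b n b-depth k b-len (Rejects A)
      ...   | A′ , A′∈ , inj₁ all-rejected = A′ , A′∈ , inj₂ rejects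
        where
          rejects : RejectsSuccessors A′ b
          rejects b-len′ c∈ with HasLength-unique b-len′ b-len
          ... | refl = Rejects-hereditary (proj₁ A′∈) (all-rejected _ c∈)
      ...   | A′ , A′∈ , inj₂ none-rejected =
              A′ , A′∈ , inj₁ (successors-accepted⇒accepted b-len accepted)
        where
          accepted : ∀ c → c ∈r[ suc k ][ b , A′ ] → Accepts A′ c
          accepted c c∈@(c∈A′ , b⊑c , _)
            with HoldsBeyond-∈[r] Decides-hereditary A∈ A₁-decides
                   c (∈AR↾-mono (proj₁ A′∈) c∈A′) (DepthAtLeast-⊑ b⊑c (DepthAtLeast-weaken d≤n (proj₂ b-depth)))
          ... | inj₁ accepts = Accepts-hereditary (proj₁ A′∈) accepts
          ... | inj₂ rejects = ⊥-elim (none-rejected c c∈ rejects)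

      rejected⇒∉ : IsOpen S X → ∀ {A d} → HoldsBeyond AcceptsOrRejectsSuccessors d A →
                   ∀ {C b} → C ∈[ b , A ] → DepthAtLeast A b d → Rejects A b → ¬ X C
      rejected⇒∉ X-open {A} A-splits {C} (C≤A , j , refl) deep rejects XC =
        Rejects⇒¬Accepts (C≤A , N + j , refl) (rejected N) accepted
        where
          N : ℕ
          N = proj₁ (X-open C XC)

          rejected : ∀ i → Rejects A (r C (i + j))
          rejected zero = rejects
          rejected (suc i)
            with A-splits (r C (i + j)) (r-∈AR↾ C≤A (i + j)) (DepthAtLeast-⊑ (r-⊑ (m≤n+m j i)) deep)
          ... | inj₁ accepts = ⊥-elim (Rejects⇒¬Accepts (C≤A , i + j , refl) (rejected i) accepts)
          ... | inj₂ successors-rejected = successors-rejected (C , refl) (r-∈r[] C≤A (n≤1+n (i + j)))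

          accepted : Accepts A (r C (N + j))
          accepted D (_ , m , eD) with A1-3 D C m (N + j) eD
          ... | refl , agree = proj₂ (X-open C XC) D (λ k k<N → agree k (<-≤-trans k<N (m≤m+n N j)))

      decided⇒homogeneous : IsOpen S X → ∀ {d A₁ A₂ a B} → A₂ ≤ A₁ → B ≤ A₂ →
        HoldsBeyond AcceptsOrRejectsSuccessors d A₂ → DepthAtLeast A₂ a d → Decides A₁ a →
        (∀ C → C ∈[ a , B ] → X C) ⊎ (∀ C → C ∈[ a , B ] → ¬ X C)
      decided⇒homogeneous _ A₂≤A₁ B≤A₂ _ _ (inj₁ accepts) =
        inj₁ λ C C∈ → accepts C (∈[]-mono (≤-trans B≤A₂ A₂≤A₁) C∈)
      decided⇒homogeneous X-open A₂≤A₁ B≤A₂ A₂-splits deep (inj₂ rejects) =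
        inj₂ λ C C∈ → rejected⇒∉ X-open A₂-splits (∈[]-mono B≤A₂ C∈) deep (Rejects-hereditary A₂≤A₁ rejects)

      open⇒Ramsey : A4 S → IsOpen S X → Ramsey S X
      open⇒Ramsey a4 X-open A a a∈ =
        let (d , a-depth) = depth-exists a∈
            (A₁ , A₁∈ , A₁-decides) = fusion Decides Decides-hereditary d A (λ _ _ → decide)
            (A₂ , A₂∈ , A₂-splits) =
              fusion AcceptsOrRejectsSuccessors AcceptsOrRejectsSuccessors-hereditary d A₁
                     (accept-or-reject-successors a4 A₁-decides)
            a-depth₁ = IsDepth-∈[r] A₁∈ a-depth
            a-depth₂ = IsDepth-∈[r] A₂∈ a-depth₁
            (B , B∈) = A3-1 A₂ a d a-depth₂ A₂ (∈[r]-refl A₂ d)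
        in B , ∈[]-mono (≤-trans (proj₁ A₂∈) (proj₁ A₁∈)) B∈ ,
           decided⇒homogeneous X-open (proj₁ A₂∈) (proj₁ B∈) A₂-splits (proj₂ a-depth₂)
                               (A₁-decides a (d , proj₁ a-depth₁) (proj₂ a-depth₁))

    clopen-Ramsey⇒A4 : (∀ (X : R → Set) → IsClopen S X → Ramsey S X) → A4 S
    clopen-Ramsey⇒A4 ramsey B a d a-depth n _ O
      with ramsey (λ C → O (r C (suc n))) (r-preimage-clopen (suc n) O) B a (d , proj₁ a-depth)
    ... | B′ , (B′≤B , j , eB′) , homogeneous
      with A3-2 B′ B a B′≤B (B′ , ≤-refl B′ , j , eB′) d a-depth
    ... | A , A∈ , _ , shrinks =
      A , A∈ , ⊎-map (λ all → ∈r[]-all O (λ C C∈ → all C (shrinks C C∈)))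
                     (λ none → ∈r[]-all (λ b → ¬ O b) (λ C C∈ → none C (shrinks C C∈)))
                     homogeneous

proposition2p12 : ExcludedMiddle 0ℓ → (S : A2Space) →
    (A4 S → ∀ (X : A2Space.R S → Set) → IsClopen S X → Ramsey S X)
    × ((∀ (X : A2Space.R S → Set) → IsClopen S X → Ramsey S X) → A4 S)
proposition2p12 em S = (λ a4 X X-clopen → open⇒Ramsey a4 (proj₁ X-clopen)) , clopen-Ramsey⇒A4
  where open A2Theory.Classical S em
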